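{- Consider Caching in Matchings on general graphs with $n$ nodes and $k$ matchings, for fixed $k\ge 2$. There is a deterministic $O(n^2k^2)$-competitive online algorithm.
   Context: Caching in Matchings on a general graph: on a node set $V$ of size $n$, requests arrive online, each being an edge $\{u,v\}$ with $u\ne v\in V$. The algorithm maintains a cache which is the union of $k$ matchings (a properly $k$-edge-colored set of edges). If a requested edge is in none of the matchings, the algorithm must insert it into one of the matchings, evicting from that matching the edges incident to its endpoints. The algorithm may add any edge to any matching at any time (keeping each a matching) and evict freely; each addition of an edge to a matching costs $1$ (so recoloring costs $1$). An online algorithm $A$ is $c$-competitive if there is $d=d(n,k)$ with $\mathrm{cost}(A(\sigma))\le c\cdot\mathrm{cost}(OPT(\sigma))+d$ for every request sequence $\sigma$, where $OPT$ is the optimal offline cost with $k$ matchings. -}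

module Defs where

open import Data.Nat using (ℕ; zero; suc; _+_; _*_; _^_; _≤_; _<ᵇ_)
open import Data.Fin using (Fin; toℕ)
open import Data.Bool using (Bool; true; false; _∧_; not; if_then_else_)
open import Data.List using (List; []; _∷_; _++_; map; allFin)
open import Data.Nat.ListAction using (sum)
open import Data.List.Relation.Binary.Pointwise using (Pointwise)
open import Data.Product using (Σ; _×_; _,_; ∃; ∃-syntax)
open import Relation.Binary.PropositionalEquality using (_≡_)
open import Relation.Nullary using (¬_)

-- A request: an edge {u,v} with u ≠ v on node set Fin n
-- (given as an ordered pair; both orders denote the same edge).
Req : ℕ → Set
Req n = Σ (Fin n × Fin n) (λ p → ¬ (Data.Product.proj₁ p ≡ Data.Product.proj₂ p))

-- A cache: k adjacency relations, one per matching (colour).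
Config : ℕ → ℕ → Set
Config n k = Fin k → Fin n → Fin n → Bool

emptyConfig : ∀ {n k} → Config n k
emptyConfig i u v = false

Valid : ∀ {n k} → Config n k → Set
Valid {n} {k} C =
  (∀ i (u v : Fin n) → C i u v ≡ C i v u) ×
  (∀ i (u : Fin n) → C i u u ≡ false) ×
  (∀ i (u v w : Fin n) → C i u v ≡ true → C i u w ≡ true → v ≡ w)

Serves : ∀ {n k} → Req n → Config n k → Set
Serves {n} {k} ((u , v) , _) C = ∃[ i ] (C i u v ≡ true)

ΣFin : (m : ℕ) → (Fin m → ℕ) → ℕ
ΣFin m f = sum (map f (allFin m))

-- Cost of moving from cache C to cache C': number of (matching, edge) pairs
-- present in C' but not in C, i.e. the number of additions of an edge to a
-- matching (a recolouring counts as an addition).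
transCost : ∀ {n k} → Config n k → Config n k → ℕ
transCost {n} {k} C C' =
  ΣFin k (λ i → ΣFin n (λ u → ΣFin n (λ v →
    if (toℕ u <ᵇ toℕ v) ∧ C' i u v ∧ not (C i u v) then 1 else 0)))

schedCost : ∀ {n k} → Config n k → List (Config n k) → ℕ
schedCost prev [] = 0
schedCost prev (C ∷ Cs) = transCost prev C + schedCost C Cs

-- An offline solution for σ: one valid cache per request (the cache right
-- after serving it), containing the requested edge.
OfflineSol : ∀ {n} (k : ℕ) → List (Req n) → List (Config n k) → Set
OfflineSol k σ Cs = Pointwise (λ r C → Valid C × Serves r C) σ Cs

-- A deterministic online algorithm: the cache after serving a prefix of the
-- request sequence is a function of that prefix only.
record Online (n k : ℕ) : Set where
  field
    config : List (Req n) → Config n k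
    valid  : ∀ h → Valid (config h)
    serve  : ∀ h r → Serves r (config (h ++ r ∷ []))

run : ∀ {n k} → Online n k → List (Req n) → List (Req n) → List (Config n k)
run A past [] = []
run A past (r ∷ rest) =
  Online.config A (past ++ r ∷ []) ∷ run A (past ++ r ∷ []) rest

onlineCost : ∀ {n k} → Online n k → List (Req n) → ℕ
onlineCost A σ = schedCost emptyConfig (run A [] σ)

-- A is c-competitive: cost(A σ) ≤ c · OPT(σ) + d for all σ, where OPT(σ)
-- is the minimum cost of an offline solution (quantifying over all offline
-- solutions is equivalent since the minimum over ℕ is attained).
Competitive : ∀ {n k} → Online n k → ℕ → Set
Competitive {n} {k} A c =
  ∃[ d ] (∀ (σ : List (Req n)) (Cs : List (Config n k)) →
           OfflineSol k σ Cs → onlineCost A σ ≤ c * schedCost emptyConfig Cs + d)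

-- The algorithm works in phases.  It remembers the set S of requests of the
-- current phase and keeps a cache covering S.  A request r joins S; if it
-- misses the cache, the cache is replaced by any covering of S ∪ {r} by k
-- matchings (found by exhaustive search), and if there is none a new phase
-- starts with S = {r}.  Each paid step inside a phase enlarges S, which never
-- exceeds nk pairs, so with the potential nk · (nk − |S|) a phase costs at most
-- (nk)² amortised.  A phase ends only when S ∪ {r} cannot be covered by k
-- matchings.  Had OPT paid nothing since the phase began, its caches would only
-- have shrunk, so its cache at the start of the phase would cover S ∪ {r};
-- hence OPT pays at least once per phase.
module Submission where

open import Defs
open import Data.Nat using (ℕ; zero; suc; _+_; _*_; _∸_; _^_; _≤_; _<_; _<ᵇ_; z≤n; s≤s)
open import Data.Nat.Properties hiding (_≟_; <-cmp; suc-injective)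
open import Data.Nat.Tactic.RingSolver using (solve-∀)
import Data.Nat.ListAction as List
open import Algebra.Properties.CommutativeMonoid.Sum +-0-commutativeMonoid
  using (sum; sum-syntax; sum-cong-≗; sum-replicate-zero; ∑-comm)
open import Data.Fin using (Fin; zero; suc; toℕ)
open import Data.Fin.Properties using (_≟_; <-cmp; any?; all?; suc-injective)
open import Data.Bool using (Bool; true; false; _∧_; _∨_; not; if_then_else_)
import Data.Bool.Properties as Bool
open import Data.List using (List; []; _∷_; _++_; map; tabulate; foldl)
open import Data.List.Properties using (map-tabulate; foldl-++)
open import Data.List.Relation.Binary.Pointwise using ([]; _∷_)
import Data.Vec.Functional as Vec
open import Data.Vec.Functional.Relation.Binary.Pointwise using (Pointwise)
open import Data.Product using (_×_; _,_; -,_; ∃; ∃-syntax; proj₁; proj₂)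
open import Data.Sum using (_⊎_; inj₁; inj₂)
open import Function using (_∘_; id)
open import Level using (0ℓ)
open import Relation.Binary.Core using (Rel)
open import Relation.Binary.Definitions using (Reflexive; _Respects_; tri<; tri≈; tri>)
open import Relation.Binary.PropositionalEquality
open import Relation.Nullary using (¬_; Dec; yes; no; does; contradiction)
open import Relation.Nullary.Decidable using (map′; dec-true; _×-dec_; _→-dec_)
open import Relation.Unary using (Pred; Decidable)

private
  variable
    m n k : ℕ

⟦_⟧ : Bool → ℕ
⟦ b ⟧ = if b then 1 else 0

⟦⟧-mono : ∀ {x y} → (x ≡ true → y ≡ true) → ⟦ x ⟧ ≤ ⟦ y ⟧
⟦⟧-mono {false} _   = z≤n
⟦⟧-mono {true}  x⇒y rewrite x⇒y refl = ≤-refl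

∧-≡-true : ∀ {x y} → x ∧ y ≡ true → x ≡ true × y ≡ true
∧-≡-true {true} {true} _ = refl , refl

∨-≡-true : ∀ {x y} → x ∨ y ≡ true → x ≡ true ⊎ y ≡ true
∨-≡-true {true}  _ = inj₁ refl
∨-≡-true {false} h = inj₂ h

amortise : ∀ {a p p′ x y} → a + p′ ≤ p → x ≤ p′ + y → a + x ≤ p + y
amortise {a} {p} {p′} {x} {y} a+p′≤p x≤p′+y = begin
  a + x          ≤⟨ +-monoʳ-≤ a x≤p′+y ⟩
  a + (p′ + y)   ≡⟨ +-assoc a p′ y ⟨
  a + p′ + y     ≤⟨ +-monoˡ-≤ y a+p′≤p ⟩
  p + y          ∎
  where open ≤-Reasoning

potential-drop : ∀ {W c m m′} → c ≤ W → m < m′ → m′ ≤ W →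
                 c + W * (W ∸ m′) ≤ W * (W ∸ m)
potential-drop {W} {c} {m} {m′} c≤W m<m′ m′≤W = begin
  c + W * (W ∸ m′)   ≤⟨ +-monoˡ-≤ _ c≤W ⟩
  W + W * (W ∸ m′)   ≡⟨ *-suc W (W ∸ m′) ⟨
  W * suc (W ∸ m′)   ≡⟨ cong (W *_) (+-∸-assoc 1 m′≤W) ⟨
  W * (suc W ∸ m′)   ≤⟨ *-monoʳ-≤ W (∸-monoʳ-≤ (suc W) m<m′) ⟩
  W * (W ∸ m)        ∎
  where open ≤-Reasoning

ΣFin≡∑ : ∀ m (f : Fin m → ℕ) → ΣFin m f ≡ ∑[ i < m ] f i
ΣFin≡∑ zero    f = refl
ΣFin≡∑ (suc m) f = cong (f zero +_) (begin
  List.sum (map f (tabulate suc))   ≡⟨ cong List.sum (map-tabulate suc f) ⟩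
  List.sum (tabulate (f ∘ suc))     ≡⟨ cong List.sum (map-tabulate id (f ∘ suc)) ⟨
  ΣFin m (f ∘ suc)                  ≡⟨ ΣFin≡∑ m (f ∘ suc) ⟩
  ∑[ i < m ] f (suc i)              ∎)
  where open ≡-Reasoning

∑-mono-≤ : {f g : Fin m → ℕ} → (∀ i → f i ≤ g i) → sum f ≤ sum g
∑-mono-≤ {zero}  f≤g = z≤n
∑-mono-≤ {suc m} f≤g = +-mono-≤ (f≤g zero) (∑-mono-≤ (f≤g ∘ suc))

∑-mono-< : {f g : Fin m → ℕ} → (∀ i → f i ≤ g i) → ∀ j → f j < g j → sum f < sum g
∑-mono-< {suc m} f≤g zero    fj<gj = +-mono-<-≤ fj<gj (∑-mono-≤ (f≤g ∘ suc))
∑-mono-< {suc m} f≤g (suc j) fj<gj = +-mono-≤-< (f≤g zero) (∑-mono-< (f≤g ∘ suc) j fj<gj)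

∑-≤-* : {f : Fin m → ℕ} (c : ℕ) → (∀ i → f i ≤ c) → sum f ≤ m * c
∑-≤-* {zero}  c f≤c = z≤n
∑-≤-* {suc m} c f≤c = +-mono-≤ (f≤c zero) (∑-≤-* c (f≤c ∘ suc))

term≤∑ : (f : Fin m → ℕ) (i : Fin m) → f i ≤ sum f
term≤∑ f zero    = m≤m+n _ _
term≤∑ f (suc i) = ≤-trans (term≤∑ (f ∘ suc) i) (m≤n+m _ _)

∑-zero : {f : Fin m → ℕ} → (∀ i → f i ≡ 0) → sum f ≡ 0
∑-zero {m} f≡0 = trans (sum-cong-≗ f≡0) (sum-replicate-zero m)

∑⟦⟧-unique : (b : Fin m → Bool) → (∀ i j → b i ≡ true → b j ≡ true → i ≡ j) →
             ∑[ i < m ] ⟦ b i ⟧ ≤ 1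
∑⟦⟧-unique {zero}  b unique = z≤n
∑⟦⟧-unique {suc m} b unique with b zero in b₀
... | true  = ≤-reflexive (cong suc (∑-zero others))
  where
  others : ∀ i → ⟦ b (suc i) ⟧ ≡ 0
  others i with b (suc i) in bᵢ
  ... | false = refl
  ... | true  = contradiction (unique zero (suc i) b₀ bᵢ) λ ()
... | false =
  ∑⟦⟧-unique (b ∘ suc) (λ i j bᵢ bⱼ → suc-injective (unique (suc i) (suc j) bᵢ bⱼ))

-- Without function extensionality, searching Fin m → A must rebuild functions
-- up to pointwise equality, hence the predicates must respect _≈_.
Searchable : (A : Set) → Rel A 0ℓ → Set₁
Searchable A _≈_ = ∀ {P : Pred A 0ℓ} → P Respects _≈_ → Decidable P → Dec (∃ P)

Bool-searchable : Searchable Bool _≡_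
Bool-searchable _ P? with P? true | P? false
... | yes p | _     = yes (true , p)
... | no _  | yes p = yes (false , p)
... | no ¬p | no ¬q = no λ { (true , p) → ¬p p ; (false , q) → ¬q q }

Vector-searchable : ∀ {A _≈_} → Reflexive _≈_ → Searchable A _≈_ →
                    ∀ m → Searchable (Vec.Vector A m) (Pointwise _≈_)
Vector-searchable ≈-refl search zero {P} respects P? =
  map′ (λ p → _ , p) (λ (f , p) → respects (λ ()) p) (P? (λ ()))
Vector-searchable {A} {_≈_} ≈-refl search (suc m) {P} respects P? =
  map′ (λ (a , f , p) → a Vec.∷ f , p)
       (λ (f , p) → Vec.head f , Vec.tail f , respects (λ { zero → ≈-refl ; (suc i) → ≈-refl }) p)
       (search startsWith-respects startsWith?)
  where
  StartsWith : Pred A 0ℓ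
  StartsWith a = ∃ λ f → P (a Vec.∷ f)
  startsWith-respects : StartsWith Respects _≈_
  startsWith-respects a≈b (f , p) = f , respects (λ { zero → a≈b ; (suc i) → ≈-refl }) p
  startsWith? : Decidable StartsWith
  startsWith? a = Vector-searchable ≈-refl search m
    (λ f≈g → respects (λ { zero → ≈-refl ; (suc i) → f≈g i })) (λ f → P? (a Vec.∷ f))

EdgeSet : ℕ → Set
EdgeSet n = Fin n → Fin n → Bool

∅ : EdgeSet n
∅ _ _ = false

_⊆ᵉ_ : EdgeSet n → EdgeSet n → Set
S ⊆ᵉ S′ = ∀ a b → S a b ≡ true → S′ a b ≡ true

size : EdgeSet n → ℕ
size {n} S = ∑[ a < n ] ∑[ b < n ] ⟦ S a b ⟧

size-mono : {S S′ : EdgeSet n} → S ⊆ᵉ S′ → size S ≤ size S′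
size-mono S⊆S′ = ∑-mono-≤ λ a → ∑-mono-≤ λ b → ⟦⟧-mono (S⊆S′ a b)

edge : Fin n → Fin n → EdgeSet n
edge u v a b = does (a ≟ u) ∧ does (b ≟ v)

edge-∋ : {u v : Fin n} → edge u v u v ≡ true
edge-∋ {u = u} {v} = cong₂ _∧_ (dec-true (u ≟ u) refl) (dec-true (v ≟ v) refl)

edge⇒≡ : {u v a b : Fin n} → edge u v a b ≡ true → a ≡ u × b ≡ v
edge⇒≡ {u = u} {v} {a} {b} h with a ≟ u | b ≟ v
edge⇒≡ h  | yes a≡u | yes b≡v = a≡u , b≡v
edge⇒≡ () | yes _   | no _
edge⇒≡ () | no _    | _

-- A request (u , v) is remembered as the ordered pair only; covering it is
-- the same as covering (v , u) because matchings are symmetric.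
insert : Req n → EdgeSet n → EdgeSet n
insert ((u , v) , _) S a b = S a b ∨ edge u v a b

insert-⊇ : ∀ {r} {S : EdgeSet n} → S ⊆ᵉ insert r S
insert-⊇ a b Sab rewrite Sab = refl

insert-∋ : ∀ {u v : Fin n} u≢v {S} → insert ((u , v) , u≢v) S u v ≡ true
insert-∋ {u = u} {v} _ {S} = trans (cong (S u v ∨_) (edge-∋ {u = u} {v})) (Bool.∨-zeroʳ (S u v))

size-insert-< : ∀ {u v : Fin n} {u≢v S} → S u v ≡ false → size S < size (insert ((u , v) , u≢v) S)
size-insert-< {u = u} {v} {u≢v} {S} Suv≡false =
  ∑-mono-< (λ a → ∑-mono-≤ (grows a)) u (∑-mono-< (grows u) v new)
  where
  r = (u , v) , u≢v
  grows : ∀ a b → ⟦ S a b ⟧ ≤ ⟦ insert r S a b ⟧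
  grows a b = ⟦⟧-mono (insert-⊇ {r = r} {S} a b)
  new : ⟦ S u v ⟧ < ⟦ insert r S u v ⟧
  new = subst₂ (λ x y → ⟦ x ⟧ < ⟦ y ⟧) (sym Suv≡false) (sym (insert-∋ u≢v {S})) ≤-refl

_⊑_ : Config n k → Config n k → Set
C ⊑ C′ = ∀ i a b → C i a b ≡ true → C′ i a b ≡ true

⊑-refl : {C : Config n k} → C ⊑ C
⊑-refl _ _ _ h = h

⊑-trans : {C C′ C″ : Config n k} → C ⊑ C′ → C′ ⊑ C″ → C ⊑ C″
⊑-trans C⊑C′ C′⊑C″ i a b = C′⊑C″ i a b ∘ C⊑C′ i a b

⊑-serves : ∀ {r} {C C′ : Config n k} → C ⊑ C′ → Serves r C → Serves r C′
⊑-serves {r = (_ , _) , _} C⊑C′ (i , h) = i , C⊑C′ i _ _ h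

emptyConfig-valid : Valid {n} {k} emptyConfig
emptyConfig-valid = (λ _ _ _ → refl) , (λ _ _ → refl) , (λ _ _ _ _ ())

degree≤1 : {C : Config n k} → Valid C → ∀ i a → ∑[ b < n ] ⟦ C i a b ⟧ ≤ 1
degree≤1 {C = C} (_ , _ , matching) i a = ∑⟦⟧-unique (C i a) (matching i a)

Covers : EdgeSet n → Config n k → Set
Covers S C = ∀ a b → S a b ≡ true → ∃[ i ] (C i a b ≡ true)

Coverable : ∀ k → EdgeSet n → Set
Coverable {n} k S = ∃ λ (C : Config n k) → Valid C × Covers S C

insert-covers : ∀ {r} {S : EdgeSet n} {C : Config n k} →
                Covers S C → Serves r C → Covers (insert r S) C
insert-covers {r = (u , v) , u≢v} {S} covers serves a b h
  with ∨-≡-true {S a b} {edge u v a b} h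
... | inj₁ Sab = covers a b Sab
... | inj₂ e with edge⇒≡ {u = u} {v} {a} {b} e
... | refl , refl = serves

-- While OPT's cache is anchored to the current phase, the phase cannot end
-- before OPT pays.
Anchored : EdgeSet n → Config n k → Set
Anchored S C = ∃ λ K → Valid K × Covers S K × C ⊑ K

anchored-insert : ∀ {r} {S : EdgeSet n} {C C′ : Config n k} →
                  Serves r C′ → C′ ⊑ C → Anchored S C → Anchored (insert r S) C′
anchored-insert {r = r} served C′⊑C (K , valid-K , covers-K , C⊑K) =
  K , valid-K , insert-covers {r = r} covers-K (⊑-serves {r = r} C′⊑K served) , C′⊑K
  where C′⊑K = ⊑-trans C′⊑C C⊑K

size-≤ : {S : EdgeSet n} {C : Config n k} → Valid C → Covers S C → size S ≤ n * k
size-≤ {n} {k} {S} {C} valid covers = ∑-≤-* k row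
  where
  open ≤-Reasoning
  covered : ∀ a b → ⟦ S a b ⟧ ≤ ∑[ i < k ] ⟦ C i a b ⟧
  covered a b with S a b in Sab
  ... | false = z≤n
  ... | true  = let (i , Ciab) = covers a b Sab in
                ≤-trans (≤-reflexive (cong ⟦_⟧ (sym Ciab))) (term≤∑ (λ i → ⟦ C i a b ⟧) i)
  row : ∀ a → ∑[ b < n ] ⟦ S a b ⟧ ≤ k
  row a = begin
    ∑[ b < n ] ⟦ S a b ⟧                ≤⟨ ∑-mono-≤ (covered a) ⟩
    ∑[ b < n ] ∑[ i < k ] ⟦ C i a b ⟧   ≡⟨ ∑-comm (λ b i → ⟦ C i a b ⟧) ⟩
    ∑[ i < k ] ∑[ b < n ] ⟦ C i a b ⟧   ≤⟨ ∑-≤-* 1 (λ i → degree≤1 valid i a) ⟩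
    k * 1                               ≡⟨ *-identityʳ k ⟩
    k                                   ∎

added : Config n k → Config n k → Fin k → Fin n → Fin n → Bool
added C C′ i a b = (toℕ a <ᵇ toℕ b) ∧ C′ i a b ∧ not (C i a b)

transCost≡∑ : (C C′ : Config n k) →
              transCost C C′ ≡ ∑[ i < k ] ∑[ a < n ] ∑[ b < n ] ⟦ added C C′ i a b ⟧
transCost≡∑ {n} {k} C C′ =
  trans (ΣFin≡∑ k _) (sum-cong-≗ λ i → trans (ΣFin≡∑ n _) (sum-cong-≗ λ a →
    ΣFin≡∑ n (λ b → ⟦ added C C′ i a b ⟧)))

added≤transCost : (C C′ : Config n k) → ∀ i a b → ⟦ added C C′ i a b ⟧ ≤ transCost C C′
added≤transCost C C′ i a b =
  ≤-trans (term≤∑ _ b) (≤-trans (term≤∑ _ a) (≤-trans (term≤∑ _ i)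
    (≤-reflexive (sym (transCost≡∑ C C′)))))

transCost-≤ : (C : Config n k) {C′ : Config n k} → Valid C′ → transCost C C′ ≤ n * k
transCost-≤ {n} {k} C {C′} valid′ = begin
  transCost C C′                                        ≡⟨ transCost≡∑ C C′ ⟩
  ∑[ i < k ] ∑[ a < n ] ∑[ b < n ] ⟦ added C C′ i a b ⟧
    ≤⟨ ∑-≤-* (n * 1) (λ i → ∑-≤-* 1 (row i)) ⟩
  k * (n * 1)                                           ≡⟨ cong (k *_) (*-identityʳ n) ⟩
  k * n                                                 ≡⟨ *-comm k n ⟩
  n * k                                                 ∎
  where
  open ≤-Reasoning
  new : ∀ i a b → ⟦ added C C′ i a b ⟧ ≤ ⟦ C′ i a b ⟧
  new i a b with toℕ a <ᵇ toℕ b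
  ... | false = z≤n
  ... | true  = ⟦⟧-mono (proj₁ ∘ ∧-≡-true)
  row : ∀ i a → ∑[ b < n ] ⟦ added C C′ i a b ⟧ ≤ 1
  row i a = ≤-trans (∑-mono-≤ (new i a)) (degree≤1 valid′ i a)

transCost-refl : (C : Config n k) → transCost C C ≡ 0
transCost-refl C = trans (transCost≡∑ C C) (∑-zero λ i → ∑-zero λ a → ∑-zero λ b →
  unchanged (toℕ a <ᵇ toℕ b) (C i a b))
  where
  unchanged : ∀ p x → ⟦ p ∧ x ∧ not x ⟧ ≡ 0
  unchanged p x rewrite Bool.∧-inverseʳ x | Bool.∧-zeroʳ p = refl

transCost≡0⇒kept : ∀ {C C′ : Config n k} {i a b} → transCost C C′ ≡ 0 → toℕ a < toℕ b →
                   C′ i a b ≡ true → C i a b ≡ true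
transCost≡0⇒kept {C = C} {C′} {i} {a} {b} free a<b C′iab with C i a b in Ciab
... | true  = refl
... | false = contradiction (subst₂ _≤_ counted free (added≤transCost C C′ i a b)) λ ()
  where
  counted : ⟦ added C C′ i a b ⟧ ≡ 1
  counted rewrite C′iab | Ciab with toℕ a <ᵇ toℕ b | <⇒<ᵇ a<b
  ... | true | _ = refl

transCost≡0⇒⊑ : {C C′ : Config n k} → Valid C → Valid C′ →
                transCost C C′ ≡ 0 → C′ ⊑ C
transCost≡0⇒⊑ {C = C} {C′} (C-sym , _ , _) (C′-sym , C′-irrefl , _) free i a b C′iab
  with <-cmp a b
... | tri< a<b _ _  = transCost≡0⇒kept {C = C} {C′} free a<b C′iab
... | tri≈ _ refl _ = contradiction (trans (sym C′iab) (C′-irrefl i a)) λ ()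
... | tri> _ _ b<a  =
  trans (C-sym i a b) (transCost≡0⇒kept {C = C} {C′} free b<a (trans (C′-sym i b a) C′iab))

single : Fin k → Fin n → Fin n → Config n k
single c u v i a b = does (i ≟ c) ∧ (edge u v a b ∨ edge u v b a)

single-valid : ∀ {c : Fin k} {u v : Fin n} → ¬ u ≡ v → Valid (single c u v)
single-valid {c = c} {u} {v} u≢v = symmetric , irreflexive , matching
  where
  ends : ∀ i a b → single c u v i a b ≡ true → (a ≡ u × b ≡ v) ⊎ (a ≡ v × b ≡ u)
  ends i a b h with ∨-≡-true (proj₂ (∧-≡-true {does (i ≟ c)} h))
  ... | inj₁ e = inj₁ (edge⇒≡ {u = u} {v} {a} {b} e)
  ... | inj₂ e = let (b≡u , a≡v) = edge⇒≡ {u = u} {v} {b} {a} e in inj₂ (a≡v , b≡u)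
  symmetric : ∀ i a b → single c u v i a b ≡ single c u v i b a
  symmetric i a b = cong (does (i ≟ c) ∧_) (Bool.∨-comm (edge u v a b) (edge u v b a))
  irreflexive : ∀ i a → single c u v i a a ≡ false
  irreflexive i a with single c u v i a a in h
  ... | false = refl
  ... | true with ends i a a h
  ... | inj₁ (a≡u , a≡v) = contradiction (trans (sym a≡u) a≡v) u≢v
  ... | inj₂ (a≡v , a≡u) = contradiction (trans (sym a≡u) a≡v) u≢v
  matching : ∀ i a b w → single c u v i a b ≡ true → single c u v i a w ≡ true → b ≡ w
  matching i a b w h h′ with ends i a b h | ends i a w h′
  ... | inj₁ (_ , b≡v)   | inj₁ (_ , w≡v)   = trans b≡v (sym w≡v)
  ... | inj₂ (_ , b≡u)   | inj₂ (_ , w≡u)   = trans b≡u (sym w≡u)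
  ... | inj₁ (a≡u , _)   | inj₂ (a≡v , _)   = contradiction (trans (sym a≡u) a≡v) u≢v
  ... | inj₂ (a≡v , _)   | inj₁ (a≡u , _)   = contradiction (trans (sym a≡u) a≡v) u≢v

single-serves : ∀ {c : Fin k} {u v : Fin n} {u≢v} → Serves ((u , v) , u≢v) (single c u v)
single-serves {c = c} {u} {v} =
  c , cong₂ _∧_ (dec-true (c ≟ c) refl) (cong (_∨ edge u v v u) (edge-∋ {u = u} {v}))

serves? : (r : Req n) → Decidable (Serves {n} {k} r)
serves? ((u , v) , _) C = any? λ i → C i u v Bool.≟ true

valid? : Decidable (Valid {n} {k})
valid? C =
  all? (λ i → all? λ a → all? λ b → C i a b Bool.≟ C i b a) ×-dec
  all? (λ i → all? λ a → C i a a Bool.≟ false) ×-dec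
  all? (λ i → all? λ a → all? λ b → all? λ w →
    (C i a b Bool.≟ true) →-dec (C i a w Bool.≟ true) →-dec (b ≟ w))

covers? : (S : EdgeSet n) → Decidable (Covers {k = k} S)
covers? S C = all? λ a → all? λ b → (S a b Bool.≟ true) →-dec any? λ i → C i a b Bool.≟ true

_≈ᶜ_ : Config n k → Config n k → Set
_≈ᶜ_ = Pointwise (Pointwise (Pointwise _≡_))

Valid-respects : Valid {n} {k} Respects _≈ᶜ_
Valid-respects C≈C′ (symmetric , irreflexive , matching) =
  (λ i a b → trans (sym (C≈C′ i a b)) (trans (symmetric i a b) (C≈C′ i b a))) ,
  (λ i a → trans (sym (C≈C′ i a a)) (irreflexive i a)) ,
  (λ i a b w h h′ → matching i a b w (trans (C≈C′ i a b) h) (trans (C≈C′ i a w) h′))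

Covers-respects : (S : EdgeSet n) → Covers {k = k} S Respects _≈ᶜ_
Covers-respects S C≈C′ covers a b Sab =
  let (i , Ciab) = covers a b Sab in i , trans (sym (C≈C′ i a b)) Ciab

Config-searchable : Searchable (Config n k) _≈ᶜ_
Config-searchable {n} {k} =
  Vector-searchable (λ _ _ → refl)
    (Vector-searchable (λ _ → refl) (Vector-searchable refl Bool-searchable n) n) k

coverable? : ∀ k (S : EdgeSet n) → Dec (Coverable k S)
coverable? k S = Config-searchable
  (λ C≈C′ (valid , covers) → Valid-respects C≈C′ valid , Covers-respects S C≈C′ covers)
  (λ C → valid? C ×-dec covers? S C)

module Algorithm (n : ℕ) {k : ℕ} (c₀ : Fin k) where

  record State : Set where
    constructor state
    field
      phase  : EdgeSet n
      cache  : Config n k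
      valid  : Valid cache
      covers : Covers phase cache
  open State

  initial : State
  initial = state ∅ emptyConfig emptyConfig-valid (λ _ _ ())

  fresh : Req n → State
  fresh r@((u , v) , u≢v) = state (insert r ∅) (single c₀ u v) (single-valid u≢v)
    (insert-covers {r = r} (λ _ _ ()) (single-serves {c = c₀} {u} {v} {u≢v}))

  data Step (s : State) (r : Req n) : State → Set where
    continue : ∀ {C} (valid′ : Valid C) (covers′ : Covers (insert r (phase s)) C) →
               C ≡ cache s ⊎ ¬ Serves r (cache s) →
               Step s r (state (insert r (phase s)) C valid′ covers′)
    restart  : ¬ Coverable k (insert r (phase s)) → Step s r (fresh r)

  step : (s : State) (r : Req n) → ∃ (Step s r)
  step s r with serves? r (cache s)
  ... | yes hit = -, continue (valid s) (insert-covers {r = r} (covers s) hit) (inj₁ refl)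
  ... | no miss with coverable? k (insert r (phase s))
  ...   | yes (C , valid′ , covers′) = -, continue valid′ covers′ (inj₂ miss)
  ...   | no uncoverable              = -, restart uncoverable

  next : State → Req n → State
  next s r = proj₁ (step s r)

  Step-serves : ∀ {s r s′} → Step s r s′ → Serves r (cache s′)
  Step-serves {s} {(u , v) , u≢v} (continue _ covers′ _) = covers′ u v (insert-∋ u≢v {phase s})
  Step-serves {r = (u , v) , u≢v} (restart _) = single-serves {c = c₀} {u} {v} {u≢v}

  online : Online n k
  online = record
    { config = λ h → cache (foldl next initial h)
    ; valid  = λ h → valid (foldl next initial h)
    ; serve  = λ h r → subst (Serves r ∘ cache) (sym (foldl-++ next initial h (r ∷ [])))
                             (Step-serves (proj₂ (step (foldl next initial h) r)))
    }

  caches : State → List (Req n) → List (Config n k)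
  caches s []      = []
  caches s (r ∷ σ) = cache (next s r) ∷ caches (next s r) σ

  run≡caches : ∀ past σ → run online past σ ≡ caches (foldl next initial past) σ
  run≡caches past []      = refl
  run≡caches past (r ∷ σ) =
    cong₂ _∷_ (cong cache after)
              (trans (run≡caches (past ++ r ∷ []) σ) (cong (λ s → caches s σ) after))
    where
    after : foldl next initial (past ++ r ∷ []) ≡ next (foldl next initial past) r
    after = foldl-++ next initial past (r ∷ [])

  W : ℕ
  W = n * k

  Φ : State → ℕ
  Φ s = W * (W ∸ size (phase s))

  continue-amortised : ∀ {s r C} → Valid C → Covers (insert r (phase s)) C →
                       C ≡ cache s ⊎ ¬ Serves r (cache s) →
                       transCost (cache s) C + W * (W ∸ size (insert r (phase s))) ≤ Φ s
  continue-amortised {s} {r} _ _ (inj₁ refl) = begin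
    transCost (cache s) (cache s) + W * (W ∸ size (insert r (phase s)))
      ≡⟨ cong (_+ W * (W ∸ size (insert r (phase s)))) (transCost-refl (cache s)) ⟩
    W * (W ∸ size (insert r (phase s)))
      ≤⟨ *-monoʳ-≤ W (∸-monoʳ-≤ W (size-mono (insert-⊇ {r = r}))) ⟩
    Φ s ∎
    where open ≤-Reasoning
  continue-amortised {s} {(u , v) , u≢v} valid′ covers′ (inj₂ miss) =
    potential-drop (transCost-≤ (cache s) valid′) (size-insert-< {u≢v = u≢v} unrequested)
                   (size-≤ valid′ covers′)
    where
    unrequested : phase s u v ≡ false
    unrequested with phase s u v in requested
    ... | false = refl
    ... | true  = contradiction (covers s u v requested) miss

  restart-amortised : ∀ {s r} → transCost (cache s) (cache (fresh r)) + Φ (fresh r) ≤ W * W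
  restart-amortised {s} {r@((u , v) , u≢v)} =
    potential-drop (transCost-≤ (cache s) (valid (fresh r)))
                   (≤-trans (s≤s z≤n) (size-insert-< {u≢v = u≢v} {∅} refl))
                   (size-≤ (valid (fresh r)) (covers (fresh r)))

  restartCount : ∀ {s r s′} → Step s r s′ → ℕ
  restartCount (continue _ _ _) = 0
  restartCount (restart _)      = 1

  restarts : State → List (Req n) → ℕ
  restarts s []      = 0
  restarts s (r ∷ σ) = restartCount (proj₂ (step s r)) + restarts (next s r) σ

  onlineCost-≤ : ∀ s σ → schedCost (cache s) (caches s σ) ≤ Φ s + W * W * restarts s σ
  onlineCost-≤ s []      = z≤n
  onlineCost-≤ s (r ∷ σ) = charge (proj₂ (step s r)) (onlineCost-≤ (next s r) σ)
    where
    charge : ∀ {s′ x R} (st : Step s r s′) → x ≤ Φ s′ + W * W * R →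
                transCost (cache s) (cache s′) + x ≤ Φ s + W * W * (restartCount st + R)
    charge (continue valid′ covers′ hit-or-miss) x≤ =
      amortise (continue-amortised {s} {r} valid′ covers′ hit-or-miss) x≤
    charge {R = R} (restart _) x≤ = begin
      _                         ≤⟨ amortise (restart-amortised {s} {r}) x≤ ⟩
      W * W + W * W * R         ≡⟨ *-suc (W * W) R ⟨
      W * W * suc R             ≤⟨ m≤n+m _ (Φ s) ⟩
      Φ s + W * W * suc R       ∎
      where open ≤-Reasoning

  fresh-anchored : ∀ {r} {C : Config n k} → Valid C → Serves r C → Anchored (phase (fresh r)) C
  fresh-anchored {r} {C} valid-C served =
    C , valid-C , insert-covers {r = r} (λ _ _ ()) served , ⊑-refl

  step-bound : ∀ {s r s′} {C′ : Config n k} {R X} (st : Step s r s′) →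
               Valid C′ → Serves r C′ →
               (Anchored (phase s′) C′ → R ≤ X) → R ≤ suc X → restartCount st + R ≤ suc X
  step-bound (continue _ _ _) _ _ _ R≤1+X = R≤1+X
  step-bound {r = r} (restart _) valid-C′ served R≤X _ =
    s≤s (R≤X (fresh-anchored {r} valid-C′ served))

  free-step-bound : ∀ {s r s′} {C C′ : Config n k} {R X} (st : Step s r s′) →
                    C′ ⊑ C → Serves r C′ → Anchored (phase s) C →
                    (Anchored (phase s′) C′ → R ≤ X) → restartCount st + R ≤ X
  free-step-bound {r = r} (continue _ _ _) C′⊑C served anchored R≤X =
    R≤X (anchored-insert {r = r} served C′⊑C anchored)
  free-step-bound {r = r} (restart uncoverable) C′⊑C served anchored _ =
    let (K , valid-K , covers-K , _) = anchored-insert {r = r} served C′⊑C anchored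
    in contradiction (K , valid-K , covers-K) uncoverable

  -- The slack 1 pays for a restart ending a phase to which OPT's cache is not
  -- anchored; a step in which OPT pays restores it.
  restarts≤cost : ∀ {s} {C : Config n k} {σ Cs} → Valid C → Anchored (phase s) C →
                  OfflineSol k σ Cs → restarts s σ ≤ schedCost C Cs
  restarts≤1+cost : ∀ {s} {C : Config n k} {σ Cs} → OfflineSol k σ Cs →
                    restarts s σ ≤ suc (schedCost C Cs)

  restarts≤cost _ _ [] = z≤n
  restarts≤cost {s} {C} {r ∷ _} {C′ ∷ _} valid-C anchored ((valid-C′ , served) ∷ sol)
    with transCost C C′ in paid
  ... | zero  = free-step-bound (proj₂ (step s r)) (transCost≡0⇒⊑ valid-C valid-C′ paid) served
                  anchored (λ anchored′ → restarts≤cost valid-C′ anchored′ sol)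
  ... | suc o = ≤-trans (step-bound (proj₂ (step s r)) valid-C′ served
                           (λ anchored′ → restarts≤cost valid-C′ anchored′ sol)
                           (restarts≤1+cost sol))
                  (s≤s (m≤n+m _ o))

  restarts≤1+cost [] = z≤n
  restarts≤1+cost {s} {C} {r ∷ _} {C′ ∷ Cs} ((valid-C′ , served) ∷ sol) =
    ≤-trans (step-bound (proj₂ (step s r)) valid-C′ served
                        (λ anchored′ → restarts≤cost valid-C′ anchored′ sol)
                        (restarts≤1+cost sol))
            (s≤s (m≤n+m (schedCost C′ Cs) (transCost C C′)))

  initial-anchored : Anchored (phase initial) (cache initial)
  initial-anchored = emptyConfig , emptyConfig-valid , (λ _ _ ()) , ⊑-refl

  competitive : Competitive online (W * W)
  competitive = Φ initial , bound
    where
    bound : ∀ σ Cs → OfflineSol k σ Cs →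
            onlineCost online σ ≤ W * W * schedCost emptyConfig Cs + Φ initial
    bound σ Cs sol = begin
      onlineCost online σ
        ≡⟨ cong (schedCost emptyConfig) (run≡caches [] σ) ⟩
      schedCost emptyConfig (caches initial σ)
        ≤⟨ onlineCost-≤ initial σ ⟩
      Φ initial + W * W * restarts initial σ
        ≤⟨ +-monoʳ-≤ (Φ initial) (*-monoʳ-≤ (W * W) restarts≤OPT) ⟩
      Φ initial + W * W * schedCost emptyConfig Cs
        ≡⟨ +-comm (Φ initial) _ ⟩
      W * W * schedCost emptyConfig Cs + Φ initial ∎
      where
      open ≤-Reasoning
      restarts≤OPT : restarts initial σ ≤ schedCost emptyConfig Cs
      restarts≤OPT = restarts≤cost emptyConfig-valid initial-anchored sol

-- Stated with n ^ 2 unfolded to n * (n * 1), which the ring solver accepts.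
square : ∀ n k → n * k * (n * k) ≡ 1 * (n * (n * 1) * (k * (k * 1)))
square = solve-∀

lemma36 : ∃[ C ] (∀ (n k : ℕ) → 2 ≤ k →
    ∃[ A ] (Competitive {n} {k} A (C * (n ^ 2 * k ^ 2))))
lemma36 = 1 , competitive-for
  where
  -- One matching suffices for the algorithm, so only k ≥ 1 is used.
  competitive-for : ∀ n k → 2 ≤ k → ∃[ A ] (Competitive {n} {k} A (1 * (n ^ 2 * k ^ 2)))
  competitive-for n zero ()
  competitive-for n (suc k) _ = online , subst (Competitive online) (square n (suc k)) competitive
    where open Algorithm n {suc k} zero
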